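{- Let $\lambda=(m,n)$ be a triangular $2$-partition and $\mu=(\mu_1,\mu_2)$, $\tau=(\tau_1,\tau_2)$ two subpartitions of $\lambda$ such that $\tau$ is in the center or on the left side. Then $\tau\preceq\mu$ in the $\nu$-Tamari lattice of $\lambda$ if and only if $\mu\subseteq\tau$, and in this case $\mathrm{dist}(\tau,\mu)=\tau_1-\mu_1+\tau_2-\mu_2$.
   Context: A $2$-partition $(m,n)$ has $m\ge n\ge0$; it is triangular if there exist positive reals $r,s$ with $\lambda_j=\lfloor r-jr/s\rfloor$ for $1\le j\le s$ and $\lambda_j=0$ for $j>s$. $\mu\subseteq\tau$ means $\mu_1\le\tau_1$, $\mu_2\le\tau_2$. A subpartition $(m-i,n-j)$ is on the left side if $i<j$, in the center if $i=j$, on the right side if $i>j$. $\nu$-Tamari order: for a subpartition $\mu$ and a line $j$ (rows counted $1,2,\dots$ from the bottom) with $\mu_j>\mu_{j+1}$, let $v=\lambda_j-\mu_j$ and $i_0$ the smallest integer with $0\le i_0<j$ such that $\lambda_k-\mu_k>v$ for all $i_0<k<j$; the rotation at line $j$ gives $\alpha$ with $\alpha_k=\mu_k-1$ for $i_0<k\le j$ and $\alpha_k=\mu_k$ otherwise; $\preceq$ is the reflexive-transitive closure of rotations. $\mathrm{dist}(\tau,\mu)$ is the length of a longest chain from $\tau$ to $\mu$. -}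

module Defs where

open import Data.Nat as ℕ using (ℕ; zero; suc; _≤_; _<_; _∸_)
open import Data.Integer as ℤ using (ℤ; +_)
open import Data.Rational as ℚ using (ℚ; 0ℚ; floor; _÷_; >-nonZero)
open import Data.Product using (Σ; ∃; _×_; _,_; proj₁; proj₂)
open import Data.Sum using (_⊎_)
open import Relation.Nullary using (¬_)
open import Relation.Binary.PropositionalEquality using (_≡_; _≢_)

Pair : Set
Pair = ℕ × ℕ

Is2Partition : Pair → Set
Is2Partition (a , b) = b ≤ a

-- Rows counted from 1 at the bottom: row 1 = first part, row 2 = second part,
-- all other rows (including the unused index 0) are 0.
row : Pair → ℕ → ℕ
row (a , b) 1 = a
row (a , b) 2 = b
row (a , b) _ = 0

ℕ→ℚ : ℕ → ℚ
ℕ→ℚ j = (+ j) ℚ./ 1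

Triangular : Pair → Set
Triangular lam =
  Σ ℚ λ r → Σ ℚ λ s → Σ (r ℚ.> 0ℚ) λ _ → Σ (s ℚ.> 0ℚ) λ s>0 →
    (j : ℕ) → 1 ≤ j →
      (ℕ→ℚ j ℚ.≤ s → + (row lam j) ≡ floor (r ℚ.- ℕ→ℚ j ℚ.* (r ÷ s) {{>-nonZero s>0}}))
      × (s ℚ.< ℕ→ℚ j → row lam j ≡ 0)

_⊆_ : Pair → Pair → Set
(a , b) ⊆ (c , d) = (a ≤ c) × (b ≤ d)

SubPartition : Pair → Pair → Set
SubPartition lam mu = Is2Partition mu × (mu ⊆ lam)

-- τ = (m - i, n - j) is in the center (i = j) or on the left side (i < j)
CenterOrLeft : Pair → Pair → Set
CenterOrLeft (m , n) (t₁ , t₂) = (m ∸ t₁) ≤ (n ∸ t₂)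

Good : Pair → Pair → ℕ → ℕ → Set
Good lam mu j i = (k : ℕ) → i < k → k < j → (row lam j ∸ row mu j) < (row lam k ∸ row mu k)

RotationAt : Pair → ℕ → Pair → Pair → Set
RotationAt lam j mu α =
  (1 ≤ j) × (row mu (suc j) < row mu j) ×
  Σ ℕ λ i₀ → (i₀ < j) × Good lam mu j i₀ × ((i : ℕ) → i < i₀ → ¬ Good lam mu j i) ×
    ((k : ℕ) → ((i₀ < k) × (k ≤ j) → row α k ≡ row mu k ∸ 1)
             × (¬ ((i₀ < k) × (k ≤ j)) → row α k ≡ row mu k))

Rotation : Pair → Pair → Pair → Set
Rotation lam mu α = Σ ℕ λ j → RotationAt lam j mu α

data TamariLe (lam : Pair) : Pair → Pair → Set where
  refl⪯ : ∀ {x} → TamariLe lam x x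
  step⪯ : ∀ {x y z} → Rotation lam x y → TamariLe lam y z → TamariLe lam x z

TamariLt : Pair → Pair → Pair → Set
TamariLt lam x y = TamariLe lam x y × (x ≢ y)

data Chain (lam : Pair) : Pair → Pair → ℕ → Set where
  done : ∀ {x} → Chain lam x x 0
  next : ∀ {x y z k} → TamariLt lam x y → Chain lam y z k → Chain lam x z (suc k)

IsDist : Pair → Pair → Pair → ℕ → Set
IsDist lam τ μ d = Chain lam τ μ d × (∀ k → Chain lam τ μ k → k ≤ d)

-- A rotation of a 2-partition lowers one or two rows by one and the row it is
-- taken at strictly, so ⪯ only descends in containment and every chain from τ
-- to μ has at most τ₁ − μ₁ + τ₂ − μ₂ steps.  Conversely, as long as the
-- current subpartition is in the center or on the left side, the rotation at
-- line 2 lowers the second row alone (λ₁ − μ₁ ≤ λ₂ − μ₂ forces i₀ = 1), and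
-- the rotation at line 1 always lowers the first row alone; lowering first
-- the second row and then the first row walks from τ to μ one cell at a time.
module Submission where

open import Defs
open import Data.Nat using (ℕ; _≤_; _∸_; _+_)
open import Data.Product using (_×_; _,_)
open import Function.Bundles using (_⇔_)

open import Data.Nat using (zero; suc; _<_; _≤?_; _<?_; z≤n; s≤s; z<s)
open import Data.Nat.Properties
open import Algebra.Properties.CommutativeSemigroup +-commutativeSemigroup
  using (interchange)
open import Data.Product using (proj₁; proj₂)
open import Data.Empty using (⊥-elim)
open import Function.Bundles using (mk⇔)
open import Relation.Nullary using (¬_; yes; no; _×-dec_)
open import Relation.Binary.PropositionalEquality
  using (_≡_; refl; sym; trans; cong₂; subst)

size : Pair → ℕ
size (a , b) = a + b

size-⊆ : ∀ {μ₁ μ₂ τ₁ τ₂} → (μ₁ , μ₂) ⊆ (τ₁ , τ₂) →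
  ((τ₁ ∸ μ₁) + (τ₂ ∸ μ₂)) + size (μ₁ , μ₂) ≡ size (τ₁ , τ₂)
size-⊆ {μ₁} {μ₂} {τ₁} {τ₂} (μ₁≤τ₁ , μ₂≤τ₂) =
  trans (interchange (τ₁ ∸ μ₁) (τ₂ ∸ μ₂) μ₁ μ₂)
        (cong₂ _+_ (m∸n+n≡m μ₁≤τ₁) (m∸n+n≡m μ₂≤τ₂))

rows-shrink : ∀ {x y} j → (∀ k → row y k ≤ row x k) → row y j < row x j →
  y ⊆ x × size y < size x
rows-shrink 1 ≤-rows <-row =
  (≤-rows 1 , ≤-rows 2) , +-mono-<-≤ <-row (≤-rows 2)
rows-shrink 2 ≤-rows <-row =
  (≤-rows 1 , ≤-rows 2) , +-mono-≤-< (≤-rows 1) <-row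
rows-shrink zero _ ()
rows-shrink (suc (suc (suc _))) _ ()

rotationAt-lowers-rows : ∀ {lam j μ α} → RotationAt lam j μ α →
  ∀ k → row α k ≤ row μ k
rotationAt-lowers-rows {j = j} {μ} (_ , _ , i₀ , _ , _ , _ , rows) k
  with (i₀ <? k) ×-dec (k ≤? j)
... | yes inside  = ≤-trans (≤-reflexive (proj₁ (rows k) inside)) (m∸n≤m (row μ k) 1)
... | no  outside = ≤-reflexive (proj₂ (rows k) outside)

rotationAt-lowers-line : ∀ {lam j μ α} → RotationAt lam j μ α → row α j < row μ j
rotationAt-lowers-line (_ , descent , _ , i₀<j , _ , _ , rows) =
  ≤-<-trans (≤-reflexive (proj₁ (rows _) (i₀<j , ≤-refl)))
            (∸-monoʳ-< z<s (≤-trans (s≤s z≤n) descent))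

rotation-shrinks : ∀ {lam μ α} → Rotation lam μ α → α ⊆ μ × size α < size μ
rotation-shrinks (j , rot) =
  rows-shrink j (rotationAt-lowers-rows rot) (rotationAt-lowers-line rot)

rotation⇒≺ : ∀ {lam μ α} → Rotation lam μ α → TamariLt lam μ α
rotation⇒≺ rot =
  step⪯ rot refl⪯ , λ { refl → <-irrefl refl (proj₂ (rotation-shrinks rot)) }

⪯⇒⊇ : ∀ {lam τ μ} → TamariLe lam τ μ → μ ⊆ τ
⪯⇒⊇ refl⪯ = ≤-refl , ≤-refl
⪯⇒⊇ (step⪯ rot rest) with proj₁ (rotation-shrinks rot) | ⪯⇒⊇ rest
... | p₁ , p₂ | q₁ , q₂ = ≤-trans q₁ p₁ , ≤-trans q₂ p₂

≺⇒size< : ∀ {lam τ μ} → TamariLt lam τ μ → size μ < size τ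
≺⇒size< (refl⪯ , τ≢τ) = ⊥-elim (τ≢τ refl)
≺⇒size< (step⪯ rot rest , _) with ⪯⇒⊇ rest
... | q₁ , q₂ = ≤-<-trans (+-mono-≤ q₁ q₂) (proj₂ (rotation-shrinks rot))

⪯-trans : ∀ {lam x y z} → TamariLe lam x y → TamariLe lam y z → TamariLe lam x z
⪯-trans refl⪯ q = q
⪯-trans (step⪯ rot p) q = step⪯ rot (⪯-trans p q)

chain⇒⪯ : ∀ {lam x y k} → Chain lam x y k → TamariLe lam x y
chain⇒⪯ done = refl⪯
chain⇒⪯ (next (p , _) c) = ⪯-trans p (chain⇒⪯ c)

chain-++ : ∀ {lam x y z k l} → Chain lam x y k → Chain lam y z l → Chain lam x z (k + l)
chain-++ done c = c
chain-++ (next p c) c′ = next p (chain-++ c c′)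

chain-length+size≤ : ∀ {lam τ μ k} → Chain lam τ μ k → k + size μ ≤ size τ
chain-length+size≤ done = ≤-refl
chain-length+size≤ (next τ≺x c) = ≤-trans (s≤s (chain-length+size≤ c)) (≺⇒size< τ≺x)

chain-length≤ : ∀ {lam μ₁ μ₂ τ₁ τ₂ k} → Chain lam (τ₁ , τ₂) (μ₁ , μ₂) k →
  k ≤ (τ₁ ∸ μ₁) + (τ₂ ∸ μ₂)
chain-length≤ {μ₁ = μ₁} {μ₂} {τ₁} {τ₂} {k} c =
  +-cancelʳ-≤ (size (μ₁ , μ₂)) k ((τ₁ ∸ μ₁) + (τ₂ ∸ μ₂))
    (subst (k + size (μ₁ , μ₂) ≤_) (sym (size-⊆ (⪯⇒⊇ (chain⇒⪯ c))))
           (chain-length+size≤ c))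

LowersRowsBetween : ℕ → ℕ → Pair → Pair → Set
LowersRowsBetween i₀ j μ α = (k : ℕ) →
  ((i₀ < k) × (k ≤ j) → row α k ≡ row μ k ∸ 1) × (¬ ((i₀ < k) × (k ≤ j)) → row α k ≡ row μ k)

lower-row₁ : ∀ {lam a b} → b ≤ a → Rotation lam (suc a , b) (a , b)
lower-row₁ {lam} {a} {b} b≤a =
  1 , ≤-refl , s≤s b≤a , 0 , z<s , nothing-between , (λ _ ()) , rows
  where
  nothing-between : Good lam (suc a , b) 1 0
  nothing-between _ 0<k k<1 = ⊥-elim (<⇒≱ k<1 0<k)
  rows : LowersRowsBetween 0 1 (suc a , b) (a , b)
  rows zero = (λ { (() , _) }) , (λ _ → refl)
  rows 1 = (λ _ → refl) , (λ outside → ⊥-elim (outside (z<s , ≤-refl)))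
  rows 2 = (λ { (_ , s≤s ()) }) , (λ _ → refl)
  rows (suc (suc (suc _))) = (λ _ → refl) , (λ _ → refl)

lower-row₂ : ∀ {m n a b} → CenterOrLeft (m , n) (a , suc b) →
  Rotation (m , n) (a , suc b) (a , b)
lower-row₂ {m} {n} {a} {b} left =
  2 , s≤s z≤n , z<s , 1 , ≤-refl , nothing-between , no-smaller-good , rows
  where
  nothing-between : Good (m , n) (a , suc b) 2 1
  nothing-between _ 1<k k<2 = ⊥-elim (<⇒≱ k<2 1<k)
  no-smaller-good : (i : ℕ) → i < 1 → ¬ Good (m , n) (a , suc b) 2 i
  no-smaller-good zero _ good = <⇒≱ (good 1 z<s ≤-refl) left
  no-smaller-good (suc _) (s≤s ()) _
  rows : LowersRowsBetween 1 2 (a , suc b) (a , b)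
  rows zero = (λ { (() , _) }) , (λ _ → refl)
  rows 1 = (λ { (s≤s () , _) }) , (λ _ → refl)
  rows 2 = (λ _ → refl) , (λ outside → ⊥-elim (outside (≤-refl , ≤-refl)))
  rows (suc (suc (suc _))) = (λ _ → refl) , (λ _ → refl)

lower-row₁-steps : ∀ {lam a b} d → b ≤ a → Chain lam (d + a , b) (a , b) d
lower-row₁-steps zero b≤a = done
lower-row₁-steps {a = a} (suc d) b≤a =
  next (rotation⇒≺ (lower-row₁ (≤-trans b≤a (m≤n+m a d)))) (lower-row₁-steps d b≤a)

lower-row₂-steps : ∀ {m n a c} d → CenterOrLeft (m , n) (a , d + c) →
  Chain (m , n) (a , d + c) (a , c) d
lower-row₂-steps zero left = done
lower-row₂-steps {n = n} {c = c} (suc d) left =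
  next (rotation⇒≺ (lower-row₂ left))
       (lower-row₂-steps d (≤-trans left (∸-monoʳ-≤ n (n≤1+n (d + c)))))

lower-row₁-chain : ∀ {lam a b c} → b ≤ c → c ≤ a → Chain lam (a , b) (c , b) (a ∸ c)
lower-row₁-chain {a = a} {c = c} b≤c c≤a with a ∸ c | m∸n+n≡m c≤a
... | d | refl = lower-row₁-steps d b≤c

lower-row₂-chain : ∀ {m n a b c} → c ≤ b → CenterOrLeft (m , n) (a , b) →
  Chain (m , n) (a , b) (a , c) (b ∸ c)
lower-row₂-chain {b = b} {c} c≤b left with b ∸ c | m∸n+n≡m c≤b
... | d | refl = lower-row₂-steps d left

descent-chain : ∀ {m n μ₁ μ₂ τ₁ τ₂} → μ₂ ≤ μ₁ → (μ₁ , μ₂) ⊆ (τ₁ , τ₂) →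
  CenterOrLeft (m , n) (τ₁ , τ₂) →
  Chain (m , n) (τ₁ , τ₂) (μ₁ , μ₂) ((τ₁ ∸ μ₁) + (τ₂ ∸ μ₂))
descent-chain {m} {n} {μ₁} {μ₂} {τ₁} {τ₂} μ₂≤μ₁ (μ₁≤τ₁ , μ₂≤τ₂) left =
  subst (Chain (m , n) (τ₁ , τ₂) (μ₁ , μ₂)) (+-comm (τ₂ ∸ μ₂) (τ₁ ∸ μ₁))
    (chain-++ (lower-row₂-chain μ₂≤τ₂ left) (lower-row₁-chain μ₂≤μ₁ μ₁≤τ₁))

proposition5p18 : (m n : ℕ) → Is2Partition (m , n) → Triangular (m , n) →
    (μ₁ μ₂ τ₁ τ₂ : ℕ) →
    SubPartition (m , n) (μ₁ , μ₂) → SubPartition (m , n) (τ₁ , τ₂) →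
    CenterOrLeft (m , n) (τ₁ , τ₂) →
    (TamariLe (m , n) (τ₁ , τ₂) (μ₁ , μ₂) ⇔ (μ₁ , μ₂) ⊆ (τ₁ , τ₂))
    × ((μ₁ , μ₂) ⊆ (τ₁ , τ₂) →
       IsDist (m , n) (τ₁ , τ₂) (μ₁ , μ₂) ((τ₁ ∸ μ₁) + (τ₂ ∸ μ₂)))
proposition5p18 m n _ _ μ₁ μ₂ τ₁ τ₂ (μ₂≤μ₁ , _) _ left =
  mk⇔ ⪯⇒⊇ (λ μ⊆τ → chain⇒⪯ (descent-chain μ₂≤μ₁ μ⊆τ left)) ,
  λ μ⊆τ → descent-chain μ₂≤μ₁ μ⊆τ left , λ _ → chain-length≤
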